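{- Let $n$ be a positive even integer and let $G=\langle A,\beta\mid \beta^2=\alpha,\ \beta a\beta^{ -1}=f(a)\ \text{for all } a\in A\rangle$ be a finite non-abelian group of order $2n$, where $A$ is an abelian subgroup of index $2$, $\alpha\in A$, and $f$ is an automorphism of $A$ of order $2$ with $f(\alpha)=\alpha$. Let $X\subseteq A\setminus\{e\}$ satisfy: (i) $B=A\setminus(X\cup f(X))$ is a subgroup of $A$ with $\alpha\in B$; (ii) $X$ is a union of cosets of $B$; (iii) $X\cap f(X)=aB$ and $X\cup aX=A$ for some $a\in A$. Then $\Gamma=\mathrm{Cay}(G,X\cup X\beta)$ is a DSRG with parameters $(2n,n,\frac{n}{2}+\ell,\frac{n}{2}-\ell,\frac{n}{2}+\ell)$, where $\ell=|B|$.
   Context: $e$ denotes the identity. For a finite group $H$ and $S\subseteq H\setminus\{e\}$, $\mathrm{Cay}(H,S)$ is the directed graph with vertex set $H$ and an arc from $x$ to $y$ iff $yx^{ -1}\in S$. $X\beta=\{x\beta:x\in X\}$, $f(X)=\{f(x):x\in X\}$, $aX=\{ax:x\in X\}$, $aB=\{ab:b\in B\}$. A DSRG with parameters $(N,k,\mu,\lambda,t)$ is a $k$-regular loopless directed graph on $N$ vertices such that every vertex $x$ has exactly $t$ vertices $z$ with $x\to z$ and $z\to x$, and for vertices $x\ne y$ the number of $z$ with $x\to z\to y$ is $\lambda$ if $x\to y$ and $\mu$ otherwise. -}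

module Defs where

open import Level using (0ℓ)
open import Algebra.Bundles using (Group)
open import Data.Nat using (ℕ)
open import Data.Fin using (Fin)
open import Data.Product using (Σ; ∃; _×_; _,_)
open import Data.Sum using (_⊎_)
open import Data.Unit using (⊤)
open import Relation.Nullary using (¬_)
open import Relation.Binary.PropositionalEquality using (_≡_)

module GroupNotions (G : Group 0ℓ 0ℓ) where
  open Group G

  Subset : Set₁
  Subset = Carrier → Set

  Respects≈ : Subset → Set
  Respects≈ P = ∀ {x y} → x ≈ y → P x → P y

  IsSubgroup : Subset → Set
  IsSubgroup H = Respects≈ H × H ε × (∀ {x y} → H x → H y → H (x ∙ y)) × (∀ {x} → H x → H (x ⁻¹))

  IsAbelianSubset : Subset → Set
  IsAbelianSubset H = ∀ {x y} → H x → H y → x ∙ y ≈ y ∙ x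

  NonAbelian : Set
  NonAbelian = ∃ λ x → ∃ λ y → ¬ (x ∙ y ≈ y ∙ x)

  HasSize : Subset → ℕ → Set
  HasSize P k = Σ (Fin k → Carrier) λ g →
      (∀ i j → g i ≈ g j → i ≡ j)
    × (∀ i → P (g i))
    × (∀ x → P x → ∃ λ i → x ≈ g i)

  _∪_ : Subset → Subset → Subset
  (P ∪ Q) x = P x ⊎ Q x

  _∩_ : Subset → Subset → Subset
  (P ∩ Q) x = P x × Q x

  SameSet : Subset → Subset → Set
  SameSet P Q = ∀ x → (P x → Q x) × (Q x → P x)

  Image : (Carrier → Carrier) → Subset → Subset
  Image f X y = ∃ λ x → X x × f x ≈ y

  RMul : Subset → Carrier → Subset
  RMul X b y = ∃ λ x → X x × x ∙ b ≈ y

  LMul : Carrier → Subset → Subset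
  LMul a X y = ∃ λ x → X x × a ∙ x ≈ y

  CayArc : Subset → Carrier → Carrier → Set
  CayArc S x y = S (y ∙ x ⁻¹)

  IsDSRG : (Carrier → Carrier → Set) → ℕ → ℕ → ℕ → ℕ → ℕ → Set
  IsDSRG E N k μ lam t =
      HasSize (λ _ → ⊤) N
    × (∀ x → ¬ E x x)
    × (∀ x → HasSize (λ z → E x z) k)
    × (∀ x → HasSize (λ z → E z x) k)
    × (∀ x → HasSize (λ z → E x z × E z x) t)
    × (∀ x y → ¬ x ≈ y → E x y → HasSize (λ z → E x z × E z y) lam)
    × (∀ x y → ¬ x ≈ y → ¬ E x y → HasSize (λ z → E x z × E z y) μ)

-- Write S = X ∪ Xβ and, for c = y x⁻¹, Mid c = {z : z ∈ S, c z⁻¹ ∈ S}, whose size is the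
-- number of 2-paths from x to y. Counting A = B ⊔ (X ∪ f(X)) with X ∩ f(X) = aB gives
-- |X| = n/2, so X and aX partition A. Splitting Mid c along the cosets A and Aβ turns
-- |Mid c| into |X ∩ dX⁻¹| + |f(X) ∩ dX⁻¹| for d = c or d = cβ⁻¹ in A, where c ∈ S iff
-- d ∈ X. By inclusion–exclusion this is |(X ∪ f(X)) ∩ dX⁻¹| + |aB ∩ dX⁻¹|, and the
-- n/2 elements of A ∩ dX⁻¹ contain all of B and none of aB when d ∈ X, and the other
-- way round when d ∉ X: the count is n/2 − ℓ or n/2 + ℓ.

module Submission where

open import Level using (0ℓ)
open import Algebra.Bundles using (Group)
open import Data.Bool as Bool using (Bool; true; false; not)
open import Data.Empty using (⊥-elim)
open import Data.Fin as Fin using (Fin; splitAt; join)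
import Data.Fin.Properties as Fin
open import Data.List using (List; []; _∷_; _++_)
import Data.List.Properties as List
open import Data.Nat as ℕ using (ℕ; zero; suc; _+_; _*_; _∸_; _<_)
import Data.Nat.Properties as ℕ
open import Data.Nat.Divisibility using (_∣_)
open import Data.Nat.DivMod using (_/_; m*n/n≡m)
open import Data.Product using (Σ; ∃; _×_; _,_; proj₁; proj₂)
import Data.Product.Properties as Product
open import Data.Sum using (_⊎_; inj₁; inj₂)
open import Data.Unit using (⊤; tt)
open import Function using (_∘_)
open import Function.Definitions using (Congruent; Injective)
open import Relation.Binary.Definitions using (DecidableEquality)
open import Relation.Binary.PropositionalEquality as ≡ using (_≡_)
open import Relation.Nullary using (¬_; Dec; yes; no)
open import Relation.Nullary.Decidable using (True; toWitness; map′; _×-dec_)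
open import Relation.Unary using (Decidable; _⊆_; ∁)
open import Relation.Unary.Properties using (_∩?_; _∪?_; ∁?)
open import Defs

module GroupWords {c e} (G : Group c e) where
  open Group G
  open import Algebra.Properties.Group G using (ε⁻¹≈ε; ⁻¹-involutive; ⁻¹-anti-homo-∙)
  open import Relation.Binary.Reasoning.Setoid setoid

  infixl 7 _⊙_
  data Term : Set where
    v   : ℕ → Term
    _⊙_ : Term → Term → Term
    inv : Term → Term

  -- Out-of-range variables denote ε.
  env : List Carrier → ℕ → Carrier
  env []      _       = ε
  env (x ∷ _) zero    = x
  env (_ ∷ ρ) (suc i) = env ρ i

  ⟦_⟧ : Term → List Carrier → Carrier
  ⟦ v i   ⟧ ρ = env ρ i
  ⟦ s ⊙ t ⟧ ρ = ⟦ s ⟧ ρ ∙ ⟦ t ⟧ ρ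
  ⟦ inv t ⟧ ρ = ⟦ t ⟧ ρ ⁻¹

  -- (i , true) is the letter for the inverse of variable i.
  Letter : Set
  Letter = ℕ × Bool

  Word : Set
  Word = List Letter

  _≟ˡ_ : DecidableEquality Letter
  _≟ˡ_ = Product.≡-dec ℕ._≟_ Bool._≟_

  _≟ʷ_ : DecidableEquality Word
  _≟ʷ_ = List.≡-dec _≟ˡ_

  invert : Letter → Letter
  invert (i , b) = i , not b

  invertʷ : Word → Word
  invertʷ []      = []
  invertʷ (l ∷ w) = invertʷ w ++ invert l ∷ []

  word : Term → Word
  word (v i)   = (i , false) ∷ []
  word (s ⊙ t) = word s ++ word t
  word (inv t) = invertʷ (word t)

  push : Letter → Word → Word
  push l []      = l ∷ []
  push l (m ∷ w) with m ≟ˡ invert l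
  ... | yes _ = w
  ... | no  _ = l ∷ m ∷ w

  reduce : Word → Word
  reduce []      = []
  reduce (l ∷ w) = push l (reduce w)

  ⟦_⟧ˡ : Letter → List Carrier → Carrier
  ⟦ i , false ⟧ˡ ρ = env ρ i
  ⟦ i , true  ⟧ˡ ρ = env ρ i ⁻¹

  ⟦_⟧ʷ : Word → List Carrier → Carrier
  ⟦ []    ⟧ʷ ρ = ε
  ⟦ l ∷ w ⟧ʷ ρ = ⟦ l ⟧ˡ ρ ∙ ⟦ w ⟧ʷ ρ

  module _ (ρ : List Carrier) where
    ⟦++⟧ : ∀ u w → ⟦ u ++ w ⟧ʷ ρ ≈ ⟦ u ⟧ʷ ρ ∙ ⟦ w ⟧ʷ ρ
    ⟦++⟧ []      w = sym (identityˡ _)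
    ⟦++⟧ (l ∷ u) w = trans (∙-congˡ (⟦++⟧ u w)) (sym (assoc _ _ _))

    ⟦invert⟧ : ∀ l → ⟦ invert l ⟧ˡ ρ ≈ ⟦ l ⟧ˡ ρ ⁻¹
    ⟦invert⟧ (i , false) = refl
    ⟦invert⟧ (i , true)  = sym (⁻¹-involutive _)

    ⟦invertʷ⟧ : ∀ w → ⟦ invertʷ w ⟧ʷ ρ ≈ ⟦ w ⟧ʷ ρ ⁻¹
    ⟦invertʷ⟧ []      = sym ε⁻¹≈ε
    ⟦invertʷ⟧ (l ∷ w) = begin
      ⟦ invertʷ w ++ invert l ∷ [] ⟧ʷ ρ         ≈⟨ ⟦++⟧ (invertʷ w) _ ⟩
      ⟦ invertʷ w ⟧ʷ ρ ∙ (⟦ invert l ⟧ˡ ρ ∙ ε)  ≈⟨ ∙-cong (⟦invertʷ⟧ w) (trans (identityʳ _) (⟦invert⟧ l)) ⟩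
      ⟦ w ⟧ʷ ρ ⁻¹ ∙ ⟦ l ⟧ˡ ρ ⁻¹                 ≈⟨ ⁻¹-anti-homo-∙ _ _ ⟨
      (⟦ l ⟧ˡ ρ ∙ ⟦ w ⟧ʷ ρ) ⁻¹                  ∎

    ⟦word⟧ : ∀ t → ⟦ word t ⟧ʷ ρ ≈ ⟦ t ⟧ ρ
    ⟦word⟧ (v i)   = identityʳ _
    ⟦word⟧ (s ⊙ t) = trans (⟦++⟧ (word s) (word t)) (∙-cong (⟦word⟧ s) (⟦word⟧ t))
    ⟦word⟧ (inv t) = trans (⟦invertʷ⟧ (word t)) (⁻¹-cong (⟦word⟧ t))

    ⟦push⟧ : ∀ l w → ⟦ push l w ⟧ʷ ρ ≈ ⟦ l ⟧ˡ ρ ∙ ⟦ w ⟧ʷ ρ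
    ⟦push⟧ l []      = refl
    ⟦push⟧ l (m ∷ w) with m ≟ˡ invert l
    ... | no  _      = refl
    ... | yes ≡.refl = begin
      ⟦ w ⟧ʷ ρ                                 ≈⟨ identityˡ _ ⟨
      ε ∙ ⟦ w ⟧ʷ ρ                             ≈⟨ ∙-congʳ (inverseʳ _) ⟨
      ⟦ l ⟧ˡ ρ ∙ ⟦ l ⟧ˡ ρ ⁻¹ ∙ ⟦ w ⟧ʷ ρ        ≈⟨ ∙-congʳ (∙-congˡ (⟦invert⟧ l)) ⟨
      ⟦ l ⟧ˡ ρ ∙ ⟦ invert l ⟧ˡ ρ ∙ ⟦ w ⟧ʷ ρ    ≈⟨ assoc _ _ _ ⟩
      ⟦ l ⟧ˡ ρ ∙ (⟦ invert l ⟧ˡ ρ ∙ ⟦ w ⟧ʷ ρ)  ∎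

    ⟦reduce⟧ : ∀ w → ⟦ reduce w ⟧ʷ ρ ≈ ⟦ w ⟧ʷ ρ
    ⟦reduce⟧ []      = refl
    ⟦reduce⟧ (l ∷ w) = trans (⟦push⟧ l (reduce w)) (∙-congˡ (⟦reduce⟧ w))

  -- Proves identities of free groups: both sides are freely reduced and compared.
  solve : (ρ : List Carrier) (s t : Term) →
          {True (reduce (word s) ≟ʷ reduce (word t))} → ⟦ s ⟧ ρ ≈ ⟦ t ⟧ ρ
  solve ρ s t {same} = begin
    ⟦ s ⟧ ρ                      ≈⟨ ⟦word⟧ ρ s ⟨
    ⟦ word s ⟧ʷ ρ                ≈⟨ ⟦reduce⟧ ρ (word s) ⟨
    ⟦ reduce (word s) ⟧ʷ ρ       ≡⟨ ≡.cong (λ w → ⟦ w ⟧ʷ ρ) (toWitness same) ⟩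
    ⟦ reduce (word t) ⟧ʷ ρ       ≈⟨ ⟦reduce⟧ ρ (word t) ⟩
    ⟦ word t ⟧ʷ ρ                ≈⟨ ⟦word⟧ ρ t ⟩
    ⟦ t ⟧ ρ                      ∎

Fin-filter : ∀ N (Q : Fin N → Set) → (∀ i → Dec (Q i)) →
  ∃ λ k → Σ (Fin k → Fin N) λ e →
    Injective _≡_ _≡_ e × (∀ i → Q (e i)) × (∀ j → Q j → ∃ λ i → e i ≡ j)
Fin-filter zero    Q Q? = 0 , (λ ()) , (λ {}) , (λ ()) , (λ ())
Fin-filter (suc N) Q Q? with Fin-filter N (Q ∘ Fin.suc) (Q? ∘ Fin.suc) | Q? Fin.zero
... | k , e , inj , mem , sur | no ¬q₀ =
  k , Fin.suc ∘ e , inj ∘ Fin.suc-injective , mem , sur′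
  where
  sur′ : ∀ j → Q j → ∃ λ i → Fin.suc (e i) ≡ j
  sur′ Fin.zero    q = ⊥-elim (¬q₀ q)
  sur′ (Fin.suc j) q = let (i , eq) = sur j q in i , ≡.cong Fin.suc eq
... | k , e , inj , mem , sur | yes q₀ = suc k , e′ , inj′ , mem′ , sur′
  where
  e′ : Fin (suc k) → Fin (suc N)
  e′ Fin.zero    = Fin.zero
  e′ (Fin.suc i) = Fin.suc (e i)
  inj′ : Injective _≡_ _≡_ e′
  inj′ {Fin.zero}  {Fin.zero}  _  = ≡.refl
  inj′ {Fin.suc i} {Fin.suc j} eq = ≡.cong Fin.suc (inj (Fin.suc-injective eq))
  mem′ : ∀ i → Q (e′ i)
  mem′ Fin.zero    = q₀
  mem′ (Fin.suc i) = mem i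
  sur′ : ∀ j → Q j → ∃ λ i → e′ i ≡ j
  sur′ Fin.zero    _ = Fin.zero , ≡.refl
  sur′ (Fin.suc j) q = let (i , eq) = sur j q in Fin.suc i , ≡.cong Fin.suc eq

module FiniteSubsets (G : Group 0ℓ 0ℓ) where
  open Group G
  open GroupNotions G

  private
    variable
      P Q R : Subset
      k m : ℕ

  ∩-resp≈ : Respects≈ P → Respects≈ Q → Respects≈ (P ∩ Q)
  ∩-resp≈ rP rQ x≈y (p , q) = rP x≈y p , rQ x≈y q

  ∪-resp≈ : Respects≈ P → Respects≈ Q → Respects≈ (P ∪ Q)
  ∪-resp≈ rP rQ x≈y (inj₁ p) = inj₁ (rP x≈y p)
  ∪-resp≈ rP rQ x≈y (inj₂ q) = inj₂ (rQ x≈y q)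

  ∁-resp≈ : Respects≈ P → Respects≈ (∁ P)
  ∁-resp≈ rP x≈y ¬p p = ¬p (rP (sym x≈y) p)

  Image-resp≈ : ∀ φ → Respects≈ (Image φ P)
  Image-resp≈ φ x≈y (z , p , φz≈x) = z , p , trans φz≈x x≈y

  HasSize-cong : P ⊆ Q → Q ⊆ P → HasSize P k → HasSize Q k
  HasSize-cong P⊆Q Q⊆P (g , inj , mem , sur) = g , inj , (λ i → P⊆Q (mem i)) , (λ x q → sur x (Q⊆P q))

  HasSize-image : ∀ φ → Congruent _≈_ _≈_ φ → Injective _≈_ _≈_ φ → HasSize P k → HasSize (Image φ P) k
  HasSize-image φ cong inj-φ (g , inj , mem , sur) =
    (λ i → φ (g i)) , (λ i j e → inj i j (inj-φ e)) , (λ i → g i , mem i , refl) ,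
    λ y (x , p , φx≈y) → let (i , x≈gi) = sur x p in i , trans (sym φx≈y) (cong x≈gi)

  HasSize-0⇒empty : HasSize P 0 → ∀ {x} → ¬ P x
  HasSize-0⇒empty (_ , _ , _ , sur) {x} p with sur x p
  ... | () , _

  empty⇒HasSize-0 : (∀ {x} → ¬ P x) → HasSize P 0
  empty⇒HasSize-0 ∅ = (λ ()) , (λ ()) , (λ ()) , (λ x p → ⊥-elim (∅ p))

  HasSize-∪ : HasSize P k → HasSize Q m → (∀ {x y} → P x → Q y → ¬ x ≈ y) → HasSize (P ∪ Q) (k + m)
  HasSize-∪ {P} {k} {Q} {m} (g , inj , mem , sur) (h , inj′ , mem′ , sur′) disjoint =
    gh ∘ splitAt k , inj-gh , mem-gh , sur-gh
    where
    gh : Fin k ⊎ Fin m → Carrier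
    gh (inj₁ i) = g i
    gh (inj₂ j) = h j

    gh-injective : ∀ s t → gh s ≈ gh t → s ≡ t
    gh-injective (inj₁ i) (inj₁ j) e = ≡.cong inj₁ (inj i j e)
    gh-injective (inj₂ i) (inj₂ j) e = ≡.cong inj₂ (inj′ i j e)
    gh-injective (inj₁ i) (inj₂ j) e = ⊥-elim (disjoint (mem i) (mem′ j) e)
    gh-injective (inj₂ i) (inj₁ j) e = ⊥-elim (disjoint (mem j) (mem′ i) (sym e))

    inj-gh : ∀ i j → gh (splitAt k i) ≈ gh (splitAt k j) → i ≡ j
    inj-gh i j e = begin
      i                         ≡⟨ Fin.join-splitAt k m i ⟨
      join k m (splitAt k i)    ≡⟨ ≡.cong (join k m) (gh-injective (splitAt k i) (splitAt k j) e) ⟩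
      join k m (splitAt k j)    ≡⟨ Fin.join-splitAt k m j ⟩
      j                         ∎
      where open ≡.≡-Reasoning

    mem-gh : ∀ i → (P ∪ Q) (gh (splitAt k i))
    mem-gh i with splitAt k i
    ... | inj₁ s = inj₁ (mem s)
    ... | inj₂ t = inj₂ (mem′ t)

    covers : ∀ {x} s → x ≈ gh s → ∃ λ i → x ≈ gh (splitAt k i)
    covers s e = join k m s , ≡.subst (λ z → _ ≈ gh z) (≡.sym (Fin.splitAt-join k m s)) e

    sur-gh : ∀ x → (P ∪ Q) x → ∃ λ i → x ≈ gh (splitAt k i)
    sur-gh x (inj₁ p) = let (s , e) = sur x p in covers (inj₁ s) e
    sur-gh x (inj₂ q) = let (t , e) = sur′ x q in covers (inj₂ t) e

  HasSize-unique : HasSize P k → HasSize P m → k ≡ m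
  HasSize-unique sP sP′ = ℕ.≤-antisym (≤-size sP sP′) (≤-size sP′ sP)
    where
    ≤-size : HasSize P k → HasSize P m → k ℕ.≤ m
    ≤-size (g , inj , mem , _) (h , _ , _ , sur) = Fin.injective⇒≤ {f = index} index-injective
      where
      index = λ i → proj₁ (sur (g i) (mem i))
      index-injective : Injective _≡_ _≡_ index
      index-injective {i} {j} eq = inj i j (trans (proj₂ (sur (g i) (mem i)))
        (trans (reflexive (≡.cong h eq)) (sym (proj₂ (sur (g j) (mem j))))))

  HasSize⇒decidable : (∀ x y → Dec (x ≈ y)) → Respects≈ P → HasSize P k → Decidable P
  HasSize⇒decidable _≈?_ rP (g , _ , mem , sur) x =
    map′ (λ (i , x≈gi) → rP (sym x≈gi) (mem i)) (sur x) (Fin.any? (λ i → x ≈? g i))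

  module Finite (N : ℕ) (enumeration : HasSize (λ _ → ⊤) N) where
    private
      g = proj₁ enumeration
      g-injective = proj₁ (proj₂ enumeration)
      index : Carrier → Fin N
      index x = proj₁ (proj₂ (proj₂ (proj₂ enumeration)) x tt)
      x≈g[index] : ∀ x → x ≈ g (index x)
      x≈g[index] x = proj₂ (proj₂ (proj₂ (proj₂ enumeration)) x tt)

    _≈?_ : ∀ x y → Dec (x ≈ y)
    x ≈? y = map′ (λ eq → trans (x≈g[index] x) (trans (reflexive (≡.cong g eq)) (sym (x≈g[index] y))))
                  (λ x≈y → g-injective _ _ (trans (sym (x≈g[index] x)) (trans x≈y (x≈g[index] y))))
                  (index x Fin.≟ index y)

    decidable⇒HasSize : Respects≈ P → Decidable P → ∃ (HasSize P)
    decidable⇒HasSize {P} rP P? with Fin-filter N (P ∘ g) (P? ∘ g)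
    ... | k , e , inj , mem , sur = k , g ∘ e , (λ i j eq → inj (g-injective _ _ eq)) , mem , sur′
      where
      sur′ : ∀ x → P x → ∃ λ i → x ≈ g (e i)
      sur′ x p = let (i , eq) = sur (index x) (rP (x≈g[index] x) p)
                 in i , trans (x≈g[index] x) (reflexive (≡.cong g (≡.sym eq)))

    ¬¬-decidable : Respects≈ P → ¬ ¬ Decidable P
    ¬¬-decidable {P} rP ¬P? = ¬¬-Fin N {P ∘ g} (λ Pg? → ¬P? (λ x →
      map′ (rP (sym (x≈g[index] x))) (rP (x≈g[index] x)) (Pg? (index x))))
      where
      ¬¬-Fin : ∀ m {Q : Fin m → Set} → ¬ ¬ (∀ i → Dec (Q i))
      ¬¬-Fin zero    ¬Q? = ¬Q? (λ ())
      ¬¬-Fin (suc m) {Q} ¬Q? = ¬¬-Fin m (λ Qs? → ¬Q? (λ where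
        Fin.zero    → no (λ q → ¬Q? (λ where Fin.zero → yes q ; (Fin.suc i) → Qs? i))
        (Fin.suc i) → Qs? i))

    partition : Respects≈ P → Decidable P → ∀ {r k₁ k₂} →
      HasSize R r → HasSize (R ∩ P) k₁ → HasSize (R ∩ ∁ P) k₂ → r ≡ k₁ + k₂
    partition {P} {R} rP P? sR sRP sR∁P =
      HasSize-unique sR (HasSize-cong forget split (HasSize-∪ sRP sR∁P disjoint))
      where
      disjoint : ∀ {x y} → (R ∩ P) x → (R ∩ ∁ P) y → ¬ x ≈ y
      disjoint (_ , px) (_ , ¬py) x≈y = ¬py (rP x≈y px)
      forget : (R ∩ P) ∪ (R ∩ ∁ P) ⊆ R
      forget (inj₁ (r , _)) = r
      forget (inj₂ (r , _)) = r
      split : R ⊆ (R ∩ P) ∪ (R ∩ ∁ P)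
      split {x} r with P? x
      ... | yes p = inj₁ (r , p)
      ... | no ¬p = inj₂ (r , ¬p)

    inclusion-exclusion : Respects≈ P → Respects≈ Q → Decidable P → Decidable Q → ∀ {u i} →
      HasSize P k → HasSize Q m → HasSize (P ∪ Q) u → HasSize (P ∩ Q) i → u + i ≡ k + m
    inclusion-exclusion {P} {Q} {k} {m} rP rQ P? Q? {u} {i} sP sQ sP∪Q sP∩Q = begin
      u + i          ≡⟨ ≡.cong (_+ i) u≡k+w ⟩
      k + w + i      ≡⟨ ℕ.+-assoc k w i ⟩
      k + (w + i)    ≡⟨ ≡.cong (k +_) (ℕ.+-comm w i) ⟩
      k + (i + w)    ≡⟨ ≡.cong (k +_) m≡i+w ⟨
      k + m          ∎
      where
      open ≡.≡-Reasoning
      Q∖P = decidable⇒HasSize (∩-resp≈ rQ (∁-resp≈ rP)) (Q? ∩? ∁? P?)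
      w = proj₁ Q∖P
      u≡k+w : u ≡ k + w
      u≡k+w = partition rP P? sP∪Q (HasSize-cong (λ p → inj₁ p , p) proj₂ sP)
        (HasSize-cong (λ (q , ¬p) → inj₂ q , ¬p) (λ where (inj₁ p , ¬p) → ⊥-elim (¬p p)
                                                          (inj₂ q , ¬p) → q , ¬p)
                      (proj₂ Q∖P))
      m≡i+w : m ≡ i + w
      m≡i+w = partition rP P? sQ (HasSize-cong (λ (p , q) → q , p) (λ (q , p) → p , q) sP∩Q) (proj₂ Q∖P)

    HasSize-∁ : Respects≈ P → HasSize P k → HasSize (∁ P) (N ∸ k)
    HasSize-∁ {P} {k} rP sP = ≡.subst (HasSize (∁ P)) c≡N∸k (proj₂ ∁P-size)
      where
      ∁P-size = decidable⇒HasSize (∁-resp≈ rP) (∁? (HasSize⇒decidable _≈?_ rP sP))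
      c≡N∸k : proj₁ ∁P-size ≡ N ∸ k
      c≡N∸k = ≡.trans (≡.sym (ℕ.m+n∸m≡n k _)) (≡.cong (_∸ k) (≡.sym
        (partition rP (HasSize⇒decidable _≈?_ rP sP) enumeration
           (HasSize-cong (tt ,_) proj₂ sP) (HasSize-cong (tt ,_) proj₂ (proj₂ ∁P-size)))))

    same-size-⊆⇒⊇ : Respects≈ P → Respects≈ Q → HasSize P k → HasSize Q k → P ⊆ Q → Q ⊆ P
    same-size-⊆⇒⊇ {P} {Q} {k} rP rQ sP sQ P⊆Q {x} q with HasSize⇒decidable _≈?_ rP sP x
    ... | yes p = p
    ... | no ¬p = ⊥-elim (HasSize-0⇒empty (≡.subst (HasSize (Q ∩ ∁ P)) w≡0 (proj₂ Q∖P)) (q , ¬p))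
      where
      P? = HasSize⇒decidable _≈?_ rP sP
      Q∖P = decidable⇒HasSize (∩-resp≈ rQ (∁-resp≈ rP)) (HasSize⇒decidable _≈?_ rQ sQ ∩? ∁? P?)
      w≡0 : proj₁ Q∖P ≡ 0
      w≡0 = ℕ.+-cancelˡ-≡ k _ 0 (≡.trans (≡.sym (partition rP P? sQ
              (HasSize-cong (λ p → P⊆Q p , p) proj₂ sP) (proj₂ Q∖P))) (≡.sym (ℕ.+-identityʳ k)))

module Theorem6Proof (G : Group 0ℓ 0ℓ) where
  open Group G
  open GroupNotions G
  open GroupWords G
  open FiniteSubsets G
  open import Algebra.Properties.Group G using (quasigroup; ⁻¹-injective)
  open import Algebra.Properties.Quasigroup quasigroup using (cancelˡ; cancelʳ)
  import Relation.Binary.Reasoning.Setoid setoid as ≈-Reasoning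

  private
    variable
      P Q : Subset
      k : ℕ

  module SubgroupProperties {H : Subset} (H-subgroup : IsSubgroup H) where
    resp : Respects≈ H
    resp = proj₁ H-subgroup
    ε-closed : H ε
    ε-closed = proj₁ (proj₂ H-subgroup)
    ∙-closed : ∀ {x y} → H x → H y → H (x ∙ y)
    ∙-closed = proj₁ (proj₂ (proj₂ H-subgroup))
    ⁻¹-closed : ∀ {x} → H x → H (x ⁻¹)
    ⁻¹-closed = proj₂ (proj₂ (proj₂ H-subgroup))

  HasSize-∙ʳ : ∀ c → Respects≈ Q → (∀ {x} → P x → Q (x ∙ c)) → (∀ {y} → Q y → P (y ∙ c ⁻¹)) →
    HasSize P k → HasSize Q k
  HasSize-∙ʳ {Q} {P} c rQ P→Q Q→P sP =
    HasSize-cong (λ (x , p , xc≈y) → rQ xc≈y (P→Q p))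
                 (λ {y} q → y ∙ c ⁻¹ , Q→P q , solve (y ∷ c ∷ []) (v 0 ⊙ inv (v 1) ⊙ v 1) (v 0))
                 (HasSize-image (_∙ c) ∙-congʳ (cancelʳ c _ _) sP)

  HasSize-⁻¹∙ : ∀ d → Respects≈ Q → (∀ {x} → P x → Q (x ⁻¹ ∙ d)) → (∀ {y} → Q y → P (d ∙ y ⁻¹)) →
    HasSize P k → HasSize Q k
  HasSize-⁻¹∙ {Q} {P} d rQ P→Q Q→P sP =
    HasSize-cong (λ (x , p , x⁻¹d≈y) → rQ x⁻¹d≈y (P→Q p))
                 (λ {y} q → d ∙ y ⁻¹ , Q→P q , solve (y ∷ d ∷ []) (inv (v 1 ⊙ inv (v 0)) ⊙ v 1) (v 0))
                 (HasSize-image (λ x → x ⁻¹ ∙ d) (λ x≈y → ∙-congʳ (⁻¹-cong x≈y))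
                                (λ eq → ⁻¹-injective (cancelʳ d _ _ eq)) sP)

  conj : Carrier → Carrier → Carrier
  conj β a = β ∙ a ∙ β ⁻¹

  residue : Subset → (Carrier → Carrier) → Subset → Subset
  residue A f X y = A y × ¬ X y × ¬ Image f X y

  module Proof
    (n : ℕ) (enumeration : HasSize (λ _ → ⊤) (2 * n))
    (A : Subset) (A-subgroup : IsSubgroup A) (A-abelian : IsAbelianSubset A) (A-size : HasSize A n)
    (α β : Carrier) (α∈A : A α) (β∉A : ¬ A β) (β²≈α : β ∙ β ≈ α)
    (f-closed : ∀ {u} → A u → A (conj β u))
    (X : Subset) (X-resp : Respects≈ X) (X-nontrivial : ∀ {x} → X x → A x × ¬ x ≈ ε)
    (B-subgroup : IsSubgroup (residue A (conj β) X)) (α∈B : residue A (conj β) X α)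
    (X-cosets : ∀ {x y} → X x → LMul x (residue A (conj β) X) y → X y)
    (a : Carrier) (a∈A : A a)
    (X∩fX≐aB : SameSet (X ∩ Image (conj β) X) (LMul a (residue A (conj β) X)))
    (X∪aX≐A : SameSet (X ∪ LMul a X) A)
    (ℓ : ℕ) (B-size : HasSize (residue A (conj β) X) ℓ)
    where

    f : Carrier → Carrier
    f = conj β

    B : Subset
    B = residue A f X

    open SubgroupProperties A-subgroup
      renaming (resp to A-resp; ε-closed to ε∈A; ∙-closed to A-∙; ⁻¹-closed to A-⁻¹)
    open SubgroupProperties B-subgroup
      using () renaming (resp to B-resp; ⁻¹-closed to B-⁻¹)
    open Finite (2 * n) enumeration

    X⊆A : X ⊆ A
    X⊆A = proj₁ ∘ X-nontrivial

    X-∙B : ∀ {x b} → X x → B b → X (x ∙ b)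
    X-∙B x∈X b∈B = X-cosets x∈X (_ , b∈B , refl)

    X-∙α⁻¹ : ∀ {y} → X y → X (y ∙ α ⁻¹)
    X-∙α⁻¹ y∈X = X-∙B y∈X (B-⁻¹ α∈B)

    X-cancel-α⁻¹ : ∀ {y} → X (y ∙ α ⁻¹) → X y
    X-cancel-α⁻¹ {y} p = X-resp (solve (y ∷ α ∷ []) (v 0 ⊙ inv (v 1) ⊙ v 1) (v 0)) (X-∙B p α∈B)

    f-cong : Congruent _≈_ _≈_ f
    f-cong x≈y = ∙-congʳ (∙-congˡ x≈y)

    f-injective : Injective _≈_ _≈_ f
    f-injective e = cancelˡ β _ _ (cancelʳ (β ⁻¹) _ _ e)

    fX-resp : Respects≈ (Image f X)
    fX-resp = Image-resp≈ f

    fX⊆A : Image f X ⊆ A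
    fX⊆A (x , x∈X , fx≈y) = A-resp fx≈y (f-closed (X⊆A x∈X))

    A? : Decidable A
    A? = HasSize⇒decidable _≈?_ A-resp A-size

    B? : Decidable B
    B? = HasSize⇒decidable _≈?_ B-resp B-size

    aB-size : HasSize (LMul a B) ℓ
    aB-size = HasSize-image (a ∙_) ∙-congˡ (cancelˡ a _ _) B-size

    module Sizes (X? : Decidable X) where
      private
        X-sized = decidable⇒HasSize X-resp X?

      ∣X∣ : ℕ
      ∣X∣ = proj₁ X-sized

      X-size : HasSize X ∣X∣
      X-size = proj₂ X-sized

      fX-size : HasSize (Image f X) ∣X∣
      fX-size = HasSize-image f f-cong f-injective X-size

      fX? : Decidable (Image f X)
      fX? = HasSize⇒decidable _≈?_ fX-resp fX-size

      n≡∣X∣+∣X∣ : n ≡ ∣X∣ + ∣X∣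
      n≡∣X∣+∣X∣ = begin
        n      ≡⟨ partition (∪-resp≈ X-resp fX-resp) (X? ∪? fX?) A-size
                    (HasSize-cong (λ p → X∪fX⊆A p , p) proj₂ (proj₂ X∪fX))
                    (HasSize-cong (λ (y∈A , ∉X , ∉fX) → y∈A , λ where (inj₁ p) → ∉X p ; (inj₂ p) → ∉fX p)
                                  (λ (y∈A , ¬p) → y∈A , ¬p ∘ inj₁ , ¬p ∘ inj₂)
                                  B-size) ⟩
        u + ℓ  ≡⟨ inclusion-exclusion X-resp fX-resp X? fX? X-size fX-size (proj₂ X∪fX)
                    (HasSize-cong (proj₂ (X∩fX≐aB _)) (proj₁ (X∩fX≐aB _)) aB-size) ⟩
        ∣X∣ + ∣X∣ ∎
        where
        open ≡.≡-Reasoning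
        X∪fX = decidable⇒HasSize (∪-resp≈ X-resp fX-resp) (X? ∪? fX?)
        u = proj₁ X∪fX
        X∪fX⊆A : X ∪ Image f X ⊆ A
        X∪fX⊆A (inj₁ p) = X⊆A p
        X∪fX⊆A (inj₂ p) = fX⊆A p

      X∩aX-empty : ∀ {y} → X y → ¬ LMul a X y
      X∩aX-empty = λ p q → HasSize-0⇒empty (≡.subst (HasSize (X ∩ LMul a X)) j≡0 (proj₂ X∩aX)) (p , q)
        where
        aX-size : HasSize (LMul a X) ∣X∣
        aX-size = HasSize-image (a ∙_) ∙-congˡ (cancelˡ a _ _) X-size
        aX? = HasSize⇒decidable _≈?_ (Image-resp≈ (a ∙_)) aX-size
        X∩aX = decidable⇒HasSize (∩-resp≈ X-resp (Image-resp≈ (a ∙_))) (X? ∩? aX?)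
        j≡0 : proj₁ X∩aX ≡ 0
        j≡0 = ℕ.+-cancelˡ-≡ n _ 0 (≡.trans
          (inclusion-exclusion X-resp (Image-resp≈ (a ∙_)) X? aX? X-size aX-size
             (HasSize-cong (proj₂ (X∪aX≐A _)) (proj₁ (X∪aX≐A _)) A-size) (proj₂ X∩aX))
          (≡.trans (≡.sym n≡∣X∣+∣X∣) (≡.sym (ℕ.+-identityʳ n))))

    -- Deciding X is only needed to reach ⊥, so it may be assumed.
    X∩aX-empty : ∀ {y} → X y → ¬ LMul a X y
    X∩aX-empty y∈X y∈aX = ¬¬-decidable X-resp (λ X? → Sizes.X∩aX-empty X? y∈X y∈aX)

    X? : Decidable X
    X? y with A? y
    ... | no  y∉A = no (y∉A ∘ X⊆A)
    ... | yes y∈A with proj₂ (X∪aX≐A y) y∈A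
    ... | inj₁ y∈X  = yes y∈X
    ... | inj₂ y∈aX = no (λ y∈X → X∩aX-empty y∈X y∈aX)

    open Sizes X? using (∣X∣; X-size; fX?; n≡∣X∣+∣X∣)

    ∙β∉A : ∀ {u} → A u → ¬ A (u ∙ β)
    ∙β∉A {u} u∈A uβ∈A =
      β∉A (A-resp (solve (u ∷ β ∷ []) (inv (v 0) ⊙ (v 0 ⊙ v 1)) (v 1)) (A-∙ (A-⁻¹ u∈A) uβ∈A))

    Aβ⊆∁A : RMul A β ⊆ ∁ A
    Aβ⊆∁A (u , u∈A , uβ≈y) y∈A = ∙β∉A u∈A (A-resp (sym uβ≈y) y∈A)

    ∁A⊆Aβ : ∀ {y} → ¬ A y → A (y ∙ β ⁻¹)
    ∁A⊆Aβ {y} y∉A with same-size-⊆⇒⊇ (Image-resp≈ (_∙ β)) (∁-resp≈ A-resp)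
                         (HasSize-image (_∙ β) ∙-congʳ (cancelʳ β _ _) A-size) ∁A-size Aβ⊆∁A y∉A
      where
      ∁A-size : HasSize (∁ A) n
      ∁A-size = ≡.subst (HasSize (∁ A)) (≡.trans (ℕ.m+n∸m≡n n _) (ℕ.+-identityʳ n))
                        (HasSize-∁ A-resp A-size)
    ... | u , u∈A , uβ≈y =
      A-resp (trans (solve (u ∷ β ∷ []) (v 0) (v 0 ⊙ v 1 ⊙ inv (v 1))) (∙-congʳ uβ≈y)) u∈A

    S : Subset
    S = X ∪ RMul X β

    S-resp : Respects≈ S
    S-resp = ∪-resp≈ X-resp (Image-resp≈ (_∙ β))

    Xβ⇒ : ∀ {y} → RMul X β y → X (y ∙ β ⁻¹)
    Xβ⇒ (w , w∈X , wβ≈y) =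
      X-resp (trans (solve (w ∷ β ∷ []) (v 0) (v 0 ⊙ v 1 ⊙ inv (v 1))) (∙-congʳ wβ≈y)) w∈X

    ⇒Xβ : ∀ {y} → X (y ∙ β ⁻¹) → RMul X β y
    ⇒Xβ {y} p = y ∙ β ⁻¹ , p , solve (y ∷ β ∷ []) (v 0 ⊙ inv (v 1) ⊙ v 1) (v 0)

    Xβ⊆∁A : RMul X β ⊆ ∁ A
    Xβ⊆∁A (w , w∈X , wβ≈y) = Aβ⊆∁A (w , X⊆A w∈X , wβ≈y)

    S∩A⊆X : ∀ {y} → A y → S y → X y
    S∩A⊆X y∈A (inj₁ y∈X)  = y∈X
    S∩A⊆X y∈A (inj₂ y∈Xβ) = ⊥-elim (Xβ⊆∁A y∈Xβ y∈A)

    S∖A⊆Xβ : ∀ {y} → ¬ A y → S y → X (y ∙ β ⁻¹)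
    S∖A⊆Xβ y∉A (inj₁ y∈X)  = ⊥-elim (y∉A (X⊆A y∈X))
    S∖A⊆Xβ y∉A (inj₂ y∈Xβ) = Xβ⇒ y∈Xβ

    S-size : HasSize S n
    S-size = ≡.subst (HasSize S) (≡.sym n≡∣X∣+∣X∣)
      (HasSize-∪ X-size (HasSize-image (_∙ β) ∙-congʳ (cancelʳ β _ _) X-size)
                 (λ x∈X y∈Xβ x≈y → Xβ⊆∁A y∈Xβ (A-resp x≈y (X⊆A x∈X))))

    S-irreflexive : ∀ x → ¬ S (x ∙ x ⁻¹)
    S-irreflexive x (inj₁ p) = proj₂ (X-nontrivial p) (inverseʳ x)
    S-irreflexive x (inj₂ q) = Xβ⊆∁A q (A-resp (sym (inverseʳ x)) ε∈A)

    out-size : ∀ x → HasSize (λ z → S (z ∙ x ⁻¹)) n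
    out-size x = HasSize-∙ʳ x (λ e → S-resp (∙-congʳ e))
      (λ {s} → S-resp (solve (s ∷ x ∷ []) (v 0) (v 0 ⊙ v 1 ⊙ inv (v 1)))) (λ s → s) S-size

    in-size : ∀ x → HasSize (λ z → S (x ∙ z ⁻¹)) n
    in-size x = HasSize-⁻¹∙ x (λ e → S-resp (∙-congˡ (⁻¹-cong e)))
      (λ {s} → S-resp (solve (s ∷ x ∷ []) (v 0) (v 1 ⊙ inv (inv (v 0) ⊙ v 1)))) (λ s → s) S-size

    S? : Decidable S
    S? = X? ∪? λ y → map′ ⇒Xβ Xβ⇒ (X? (y ∙ β ⁻¹))

    Mid : Carrier → Subset
    Mid c z = S z × S (c ∙ z ⁻¹)

    Mid-resp : ∀ c → Respects≈ (Mid c)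
    Mid-resp c z≈z′ (p , q) = S-resp z≈z′ p , S-resp (∙-congˡ (⁻¹-cong z≈z′)) q

    paths-size : ∀ {x y} → HasSize (Mid (y ∙ x ⁻¹)) k → HasSize (λ z → CayArc S x z × CayArc S z y) k
    paths-size {x = x} {y} = HasSize-∙ʳ x
      (∩-resp≈ (λ e → S-resp (∙-congʳ e)) (λ e → S-resp (∙-congˡ (⁻¹-cong e))))
      (λ {s} (p , q) → S-resp (solve (s ∷ x ∷ []) (v 0) (v 0 ⊙ v 1 ⊙ inv (v 1))) p ,
                       S-resp (solve (s ∷ x ∷ y ∷ []) (v 2 ⊙ inv (v 1) ⊙ inv (v 0))
                                                      (v 2 ⊙ inv (v 0 ⊙ v 1))) q)
      (λ {z} (p , q) → p , S-resp (solve (z ∷ x ∷ y ∷ []) (v 2 ⊙ inv (v 0))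
                                                        (v 2 ⊙ inv (v 1) ⊙ inv (v 0 ⊙ inv (v 1)))) q)

    Mid-size-by-cosets : ∀ c {k₁ k₂} → HasSize (Mid c ∩ A) k₁ → HasSize (λ u → A u × Mid c (u ∙ β)) k₂ →
      HasSize (Mid c) (k₁ + k₂)
    Mid-size-by-cosets c s₁ s₂ =
      ≡.subst (HasSize (Mid c)) (partition A-resp A? (proj₂ Mid-sized) s₁ Mid∖A-size) (proj₂ Mid-sized)
      where
      Mid-sized = decidable⇒HasSize (Mid-resp c) (λ z → S? z ×-dec S? (c ∙ z ⁻¹))
      Mid∖A-size = HasSize-∙ʳ β (∩-resp≈ (Mid-resp c) (∁-resp≈ A-resp))
        (λ (u∈A , m) → m , ∙β∉A u∈A)
        (λ {y} (m , y∉A) → ∁A⊆Aβ y∉A , Mid-resp c (solve (y ∷ β ∷ []) (v 0) (v 0 ⊙ inv (v 1) ⊙ v 1)) m)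
        s₂

    module MidCount (d : Carrier) (d∈A : A d) where
      D : Subset
      D z = X (d ∙ z ⁻¹)

      D-resp : Respects≈ D
      D-resp z≈z′ = X-resp (∙-congˡ (⁻¹-cong z≈z′))

      D? : Decidable D
      D? z = X? (d ∙ z ⁻¹)

      private
        X∩D = decidable⇒HasSize (∩-resp≈ X-resp D-resp) (X? ∩? D?)
        X∩f⁻¹D = decidable⇒HasSize (∩-resp≈ X-resp (λ e → D-resp (f-cong e))) (X? ∩? (D? ∘ f))

      k₁ : ℕ
      k₁ = proj₁ X∩D

      k₂ : ℕ
      k₂ = proj₁ X∩f⁻¹D

      X∩D-size : HasSize (X ∩ D) k₁
      X∩D-size = proj₂ X∩D

      X∩f⁻¹D-size : HasSize (X ∩ (D ∘ f)) k₂
      X∩f⁻¹D-size = proj₂ X∩f⁻¹D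

      private
        fX∩D-size : HasSize (Image f X ∩ D) k₂
        fX∩D-size = HasSize-cong
          (λ (w , (w∈X , fw∈D) , fw≈z) → (w , w∈X , fw≈z) , D-resp fw≈z fw∈D)
          (λ ((w , w∈X , fw≈z) , z∈D) → w , (w∈X , D-resp (sym fw≈z) z∈D) , fw≈z)
          (HasSize-image f f-cong f-injective X∩f⁻¹D-size)

        A∩D-size : HasSize (A ∩ D) ∣X∣
        A∩D-size = HasSize-⁻¹∙ d (∩-resp≈ A-resp D-resp)
          (λ {s} s∈X → A-∙ (A-⁻¹ (X⊆A s∈X)) d∈A ,
                       X-resp (solve (s ∷ d ∷ []) (v 0) (v 1 ⊙ inv (inv (v 0) ⊙ v 1))) s∈X)
          proj₂ X-size

        XD-resp : Respects≈ (X ∩ D)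
        XD-resp = ∩-resp≈ X-resp D-resp
        fXD-resp : Respects≈ (Image f X ∩ D)
        fXD-resp = ∩-resp≈ fX-resp D-resp
        XD? : Decidable (X ∩ D)
        XD? = X? ∩? D?
        fXD? : Decidable (Image f X ∩ D)
        fXD? = fX? ∩? D?
        U = decidable⇒HasSize (∪-resp≈ XD-resp fXD-resp) (XD? ∪? fXD?)
        I = decidable⇒HasSize (∩-resp≈ XD-resp fXD-resp) (XD? ∩? fXD?)
        B∩D = decidable⇒HasSize (∩-resp≈ B-resp D-resp) (B? ∩? D?)
        u = proj₁ U
        i = proj₁ I
        b = proj₁ B∩D

        -- A ∩ D splits into (X ∪ f(X)) ∩ D and B ∩ D.
        ∣X∣≡u+b : ∣X∣ ≡ u + b
        ∣X∣≡u+b = partition (∪-resp≈ X-resp fX-resp) (X? ∪? fX?) A∩D-size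
          (HasSize-cong (λ where (inj₁ (p , q)) → (X⊆A p , q) , inj₁ p
                                 (inj₂ (p , q)) → (fX⊆A p , q) , inj₂ p)
                        (λ where ((_ , q) , inj₁ p) → inj₁ (p , q)
                                 ((_ , q) , inj₂ p) → inj₂ (p , q))
                        (proj₂ U))
          (HasSize-cong (λ ((y∈A , ∉X , ∉fX) , q) → (y∈A , q) , λ where (inj₁ p) → ∉X p
                                                                        (inj₂ p) → ∉fX p)
                        (λ ((y∈A , q) , ¬p) → (y∈A , ¬p ∘ inj₁ , ¬p ∘ inj₂) , q)
                        (proj₂ B∩D))

        k₁+k₂+b≡∣X∣+i : k₁ + k₂ + b ≡ ∣X∣ + i
        k₁+k₂+b≡∣X∣+i = begin
          k₁ + k₂ + b    ≡⟨ ≡.cong (_+ b) (inclusion-exclusion XD-resp fXD-resp XD? fXD?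
                                             X∩D-size fX∩D-size (proj₂ U) (proj₂ I)) ⟨
          u + i + b      ≡⟨ ℕ.+-assoc u i b ⟩
          u + (i + b)    ≡⟨ ≡.cong (u +_) (ℕ.+-comm i b) ⟩
          u + (b + i)    ≡⟨ ℕ.+-assoc u b i ⟨
          u + b + i      ≡⟨ ≡.cong (_+ i) ∣X∣≡u+b ⟨
          ∣X∣ + i        ∎
          where open ≡.≡-Reasoning

        I⊆aB : ∀ {z} → (X ∩ D) z × (Image f X ∩ D) z → LMul a B z
        I⊆aB ((z∈X , _) , (z∈fX , _)) = proj₁ (X∩fX≐aB _) (z∈X , z∈fX)

        aB∩D⊆I : ∀ {z} → LMul a B z → D z → (X ∩ D) z × (Image f X ∩ D) z
        aB∩D⊆I z∈aB z∈D = let (z∈X , z∈fX) = proj₂ (X∩fX≐aB _) z∈aB in (z∈X , z∈D) , (z∈fX , z∈D)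

        B⊆D : X d → B ⊆ D
        B⊆D d∈X z∈B = X-∙B d∈X (B-⁻¹ z∈B)

        B∩D-empty : ¬ X d → ∀ {z} → B z → ¬ D z
        B∩D-empty d∉X {z} z∈B z∈D =
          d∉X (X-resp (solve (d ∷ z ∷ []) (v 0 ⊙ inv (v 1) ⊙ v 1) (v 0)) (X-∙B z∈D z∈B))

        -- Otherwise d a⁻¹ ∈ X, i.e. d ∈ aX.
        aB∩D-empty : X d → ∀ {z} → LMul a B z → ¬ D z
        aB∩D-empty d∈X {z} (w , w∈B , aw≈z) z∈D = X∩aX-empty d∈X (d ∙ a ⁻¹ , da⁻¹∈X , a[da⁻¹]≈d)
          where
          w∈A = proj₁ w∈B
          dz⁻¹w≈da⁻¹ : d ∙ z ⁻¹ ∙ w ≈ d ∙ a ⁻¹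
          dz⁻¹w≈da⁻¹ = begin
            d ∙ z ⁻¹ ∙ w               ≈⟨ ∙-congʳ (∙-congˡ (⁻¹-cong aw≈z)) ⟨
            d ∙ (a ∙ w) ⁻¹ ∙ w         ≈⟨ solve (d ∷ a ∷ w ∷ []) (v 0 ⊙ inv (v 1 ⊙ v 2) ⊙ v 2)
                                                                (v 0 ⊙ (inv (v 2) ⊙ (inv (v 1) ⊙ v 2))) ⟩
            d ∙ (w ⁻¹ ∙ (a ⁻¹ ∙ w))    ≈⟨ ∙-congˡ (∙-congˡ (A-abelian (A-⁻¹ a∈A) w∈A)) ⟩
            d ∙ (w ⁻¹ ∙ (w ∙ a ⁻¹))    ≈⟨ solve (d ∷ a ∷ w ∷ []) (v 0 ⊙ (inv (v 2) ⊙ (v 2 ⊙ inv (v 1))))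
                                                                (v 0 ⊙ inv (v 1)) ⟩
            d ∙ a ⁻¹                   ∎
            where open ≈-Reasoning
          da⁻¹∈X : X (d ∙ a ⁻¹)
          da⁻¹∈X = X-resp dz⁻¹w≈da⁻¹ (X-∙B z∈D w∈B)
          a[da⁻¹]≈d : a ∙ (d ∙ a ⁻¹) ≈ d
          a[da⁻¹]≈d = trans (A-abelian a∈A (A-∙ d∈A (A-⁻¹ a∈A)))
                            (solve (d ∷ a ∷ []) (v 0 ⊙ inv (v 1) ⊙ v 1) (v 0))

        -- Now d = a u with u ∈ X, and d z⁻¹ = u w⁻¹ for z = a w.
        aB⊆D : ¬ X d → LMul a B ⊆ D
        aB⊆D d∉X {z} (w , w∈B , aw≈z) with proj₂ (X∪aX≐A d) d∈A
        ... | inj₁ d∈X = ⊥-elim (d∉X d∈X)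
        ... | inj₂ (u , u∈X , au≈d) = X-resp uw⁻¹≈dz⁻¹ (X-∙B u∈X (B-⁻¹ w∈B))
          where
          uw⁻¹∈A = A-∙ (X⊆A u∈X) (A-⁻¹ (proj₁ w∈B))
          uw⁻¹≈dz⁻¹ : u ∙ w ⁻¹ ≈ d ∙ z ⁻¹
          uw⁻¹≈dz⁻¹ = begin
            u ∙ w ⁻¹                 ≈⟨ solve (u ∷ w ∷ a ∷ []) (v 0 ⊙ inv (v 1))
                                                              (v 0 ⊙ inv (v 1) ⊙ v 2 ⊙ inv (v 2)) ⟩
            u ∙ w ⁻¹ ∙ a ∙ a ⁻¹      ≈⟨ ∙-congʳ (A-abelian a∈A uw⁻¹∈A) ⟨
            a ∙ (u ∙ w ⁻¹) ∙ a ⁻¹    ≈⟨ solve (u ∷ w ∷ a ∷ []) (v 2 ⊙ (v 0 ⊙ inv (v 1)) ⊙ inv (v 2))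
                                                              (v 2 ⊙ v 0 ⊙ inv (v 2 ⊙ v 1)) ⟩
            a ∙ u ∙ (a ∙ w) ⁻¹       ≈⟨ ∙-cong au≈d (⁻¹-cong aw≈z) ⟩
            d ∙ z ⁻¹                 ∎
            where open ≈-Reasoning

      k₁+k₂≡∣X∣∸ℓ : X d → k₁ + k₂ ≡ ∣X∣ ∸ ℓ
      k₁+k₂≡∣X∣∸ℓ d∈X = begin
        k₁ + k₂              ≡⟨ ℕ.m+n∸n≡m (k₁ + k₂) ℓ ⟨
        k₁ + k₂ + ℓ ∸ ℓ      ≡⟨ ≡.cong (λ m → k₁ + k₂ + m ∸ ℓ) b≡ℓ ⟨
        k₁ + k₂ + b ∸ ℓ      ≡⟨ ≡.cong (_∸ ℓ) k₁+k₂+b≡∣X∣+i ⟩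
        ∣X∣ + i ∸ ℓ          ≡⟨ ≡.cong (λ m → ∣X∣ + m ∸ ℓ) i≡0 ⟩
        ∣X∣ + 0 ∸ ℓ          ≡⟨ ≡.cong (_∸ ℓ) (ℕ.+-identityʳ ∣X∣) ⟩
        ∣X∣ ∸ ℓ              ∎
        where
        open ≡.≡-Reasoning
        b≡ℓ : b ≡ ℓ
        b≡ℓ = HasSize-unique (proj₂ B∩D) (HasSize-cong (λ z∈B → z∈B , B⊆D d∈X z∈B) proj₁ B-size)
        i≡0 : i ≡ 0
        i≡0 = HasSize-unique (proj₂ I)
          (empty⇒HasSize-0 (λ z∈I → aB∩D-empty d∈X (I⊆aB z∈I) (proj₂ (proj₁ z∈I))))

      k₁+k₂≡∣X∣+ℓ : ¬ X d → k₁ + k₂ ≡ ∣X∣ + ℓ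
      k₁+k₂≡∣X∣+ℓ d∉X = begin
        k₁ + k₂              ≡⟨ ℕ.+-identityʳ (k₁ + k₂) ⟨
        k₁ + k₂ + 0          ≡⟨ ≡.cong (k₁ + k₂ +_) b≡0 ⟨
        k₁ + k₂ + b          ≡⟨ k₁+k₂+b≡∣X∣+i ⟩
        ∣X∣ + i              ≡⟨ ≡.cong (∣X∣ +_) i≡ℓ ⟩
        ∣X∣ + ℓ              ∎
        where
        open ≡.≡-Reasoning
        b≡0 : b ≡ 0
        b≡0 = HasSize-unique (proj₂ B∩D) (empty⇒HasSize-0 (λ (z∈B , z∈D) → B∩D-empty d∉X z∈B z∈D))
        i≡ℓ : i ≡ ℓ
        i≡ℓ = HasSize-unique (proj₂ I)
          (HasSize-cong (λ z∈aB → aB∩D⊆I z∈aB (aB⊆D d∉X z∈aB)) I⊆aB aB-size)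

    Mid-size-A : ∀ {c} (c∈A : A c) → let open MidCount c c∈A in HasSize (Mid c) (k₁ + k₂)
    Mid-size-A {c} c∈A = Mid-size-by-cosets c
      (HasSize-cong (λ (z∈X , z∈D) → (inj₁ z∈X , inj₁ z∈D) , X⊆A z∈X)
                    (λ ((p , q) , z∈A) → S∩A⊆X z∈A p , S∩A⊆X (A-∙ c∈A (A-⁻¹ z∈A)) q)
                    X∩D-size)
      (HasSize-cong (λ {u} (u∈X , q) → X⊆A u∈X , inj₂ (u , u∈X , refl) ,
                                        inj₂ (⇒Xβ (X-resp (sym (shift (X⊆A u∈X))) (X-∙α⁻¹ q))))
                    (λ {u} (u∈A , p , q) → X-resp (solve (u ∷ β ∷ []) (v 0 ⊙ v 1 ⊙ inv (v 1)) (v 0))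
                                                  (S∖A⊆Xβ (∙β∉A u∈A) p) ,
                                           X-cancel-α⁻¹ (X-resp (shift u∈A) (S∖A⊆Xβ (∉A u∈A) q)))
                    X∩f⁻¹D-size)
      where
      open MidCount c c∈A
      ∉A : ∀ {u} → A u → ¬ A (c ∙ (u ∙ β) ⁻¹)
      ∉A {u} u∈A p = ∙β∉A u∈A
        (A-resp (solve (c ∷ u ∷ β ∷ []) (inv (v 0 ⊙ inv (v 1 ⊙ v 2)) ⊙ v 0) (v 1 ⊙ v 2))
                (A-∙ (A-⁻¹ p) c∈A))
      shift : ∀ {u} → A u → c ∙ (u ∙ β) ⁻¹ ∙ β ⁻¹ ≈ c ∙ f u ⁻¹ ∙ α ⁻¹
      shift {u} u∈A = begin
        c ∙ (u ∙ β) ⁻¹ ∙ β ⁻¹      ≈⟨ solve (c ∷ u ∷ β ∷ []) (v 0 ⊙ inv (v 1 ⊙ v 2) ⊙ inv (v 2))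
                                             (v 0 ⊙ (inv (v 2 ⊙ v 2) ⊙ inv (v 2 ⊙ v 1 ⊙ inv (v 2)))) ⟩
        c ∙ ((β ∙ β) ⁻¹ ∙ f u ⁻¹)  ≈⟨ ∙-congˡ (∙-congʳ (⁻¹-cong β²≈α)) ⟩
        c ∙ (α ⁻¹ ∙ f u ⁻¹)        ≈⟨ ∙-congˡ (A-abelian (A-⁻¹ α∈A) (A-⁻¹ (f-closed u∈A))) ⟩
        c ∙ (f u ⁻¹ ∙ α ⁻¹)        ≈⟨ assoc _ _ _ ⟨
        c ∙ f u ⁻¹ ∙ α ⁻¹          ∎
        where open ≈-Reasoning

    Mid-size-∁A : ∀ {c} (c∉A : ¬ A c) →
      let open MidCount (c ∙ β ⁻¹) (∁A⊆Aβ c∉A) in HasSize (Mid c) (k₁ + k₂)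
    Mid-size-∁A {c} c∉A = ≡.subst (HasSize (Mid c)) (ℕ.+-comm k₂ k₁) (Mid-size-by-cosets c
      (HasSize-cong (λ {z} (z∈X , q) → (inj₁ z∈X , inj₂ (⇒Xβ (X-resp (sym (shift z)) q))) , X⊆A z∈X)
                    (λ {z} ((p , q) , z∈A) → S∩A⊆X z∈A p , X-resp (shift z) (S∖A⊆Xβ (∉A z∈A) q))
                    X∩f⁻¹D-size)
      (HasSize-cong (λ {u} (u∈X , q) → X⊆A u∈X , inj₂ (u , u∈X , refl) , inj₁ (X-resp (unshift u) q))
                    (λ {u} (u∈A , p , q) → X-resp (solve (u ∷ β ∷ []) (v 0 ⊙ v 1 ⊙ inv (v 1)) (v 0))
                                                  (S∖A⊆Xβ (∙β∉A u∈A) p) ,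
                                           X-resp (sym (unshift u))
                                             (S∩A⊆X (A-resp (unshift u) (A-∙ d∈A (A-⁻¹ u∈A))) q))
                    X∩D-size))
      where
      d = c ∙ β ⁻¹
      d∈A = ∁A⊆Aβ c∉A
      open MidCount d d∈A
      ∉A : ∀ {z} → A z → ¬ A (c ∙ z ⁻¹)
      ∉A {z} z∈A p = c∉A (A-resp (solve (c ∷ z ∷ []) (v 0 ⊙ inv (v 1) ⊙ v 1) (v 0)) (A-∙ p z∈A))
      shift : ∀ z → c ∙ z ⁻¹ ∙ β ⁻¹ ≈ d ∙ f z ⁻¹
      shift z = solve (c ∷ z ∷ β ∷ []) (v 0 ⊙ inv (v 1) ⊙ inv (v 2))
                                        (v 0 ⊙ inv (v 2) ⊙ inv (v 2 ⊙ v 1 ⊙ inv (v 2)))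
      unshift : ∀ u → d ∙ u ⁻¹ ≈ c ∙ (u ∙ β) ⁻¹
      unshift u = solve (c ∷ u ∷ β ∷ []) (v 0 ⊙ inv (v 2) ⊙ inv (v 1)) (v 0 ⊙ inv (v 1 ⊙ v 2))

    Mid-size : ∀ c → (S c → HasSize (Mid c) (∣X∣ ∸ ℓ)) × (¬ S c → HasSize (Mid c) (∣X∣ + ℓ))
    Mid-size c with A? c
    ... | yes c∈A =
      (λ c∈S → ≡.subst (HasSize (Mid c)) (k₁+k₂≡∣X∣∸ℓ (S∩A⊆X c∈A c∈S)) (Mid-size-A c∈A)) ,
      (λ c∉S → ≡.subst (HasSize (Mid c)) (k₁+k₂≡∣X∣+ℓ (c∉S ∘ inj₁)) (Mid-size-A c∈A))
      where open MidCount c c∈A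
    ... | no  c∉A =
      (λ c∈S → ≡.subst (HasSize (Mid c)) (k₁+k₂≡∣X∣∸ℓ (S∖A⊆Xβ c∉A c∈S)) (Mid-size-∁A c∉A)) ,
      (λ c∉S → ≡.subst (HasSize (Mid c)) (k₁+k₂≡∣X∣+ℓ (c∉S ∘ inj₂ ∘ ⇒Xβ)) (Mid-size-∁A c∉A))
      where open MidCount (c ∙ β ⁻¹) (∁A⊆Aβ c∉A)

    n/2≡∣X∣ : n / 2 ≡ ∣X∣
    n/2≡∣X∣ = begin
      n / 2                 ≡⟨ ≡.cong (_/ 2) n≡∣X∣+∣X∣ ⟩
      (∣X∣ + ∣X∣) / 2       ≡⟨ ≡.cong (λ m → (∣X∣ + m) / 2) (ℕ.+-identityʳ ∣X∣) ⟨
      2 * ∣X∣ / 2           ≡⟨ ≡.cong (_/ 2) (ℕ.*-comm 2 ∣X∣) ⟩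
      ∣X∣ * 2 / 2           ≡⟨ m*n/n≡m ∣X∣ 2 ⟩
      ∣X∣                   ∎
      where open ≡.≡-Reasoning

    isDSRG : IsDSRG (CayArc S) (2 * n) n (n / 2 + ℓ) (n / 2 ∸ ℓ) (n / 2 + ℓ)
    isDSRG = ≡.subst (λ m → IsDSRG (CayArc S) (2 * n) n (m + ℓ) (m ∸ ℓ) (m + ℓ)) (≡.sym n/2≡∣X∣) (
      enumeration , S-irreflexive , out-size , in-size ,
      (λ x → paths-size (proj₂ (Mid-size (x ∙ x ⁻¹)) (S-irreflexive x))) ,
      (λ x y _ y←x → paths-size (proj₁ (Mid-size (y ∙ x ⁻¹)) y←x)) ,
      (λ x y _ y↚x → paths-size (proj₂ (Mid-size (y ∙ x ⁻¹)) y↚x)))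

theorem6 : (G : Group 0ℓ 0ℓ) →
  let open Group G
      open GroupNotions G
  in
  (n : ℕ) → 0 < n → 2 ∣ n →
  HasSize (λ _ → ⊤) (2 * n) →
  NonAbelian →
  (A : Subset) → IsSubgroup A → IsAbelianSubset A → HasSize A n →
  (α β : Carrier) → A α → ¬ A β → β ∙ β ≈ α →
  let f : Carrier → Carrier
      f a = β ∙ a ∙ β ⁻¹
  in
  (∀ {a} → A a → A (f a)) →
  (∀ {a} → A a → f (f a) ≈ a) →
  ¬ (∀ {a} → A a → f a ≈ a) →
  f α ≈ α →
  (X : Subset) → Respects≈ X →
  (∀ {x} → X x → A x × ¬ x ≈ ε) →
  let B : Subset
      B y = A y × ¬ X y × ¬ Image f X y
  in
  IsSubgroup B → B α →
  (∀ {x y} → X x → LMul x B y → X y) →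
  (∃ λ a → A a × SameSet (X ∩ Image f X) (LMul a B) × SameSet (X ∪ LMul a X) A) →
  (ℓ : ℕ) → HasSize B ℓ →
  IsDSRG (CayArc (X ∪ RMul X β)) (2 * n) n (n / 2 + ℓ) (n / 2 ∸ ℓ) (n / 2 + ℓ)
theorem6 G n _ _ enumeration _ A A-subgroup A-abelian A-size α β α∈A β∉A β²≈α f-closed _ _ _
         X X-resp X-nontrivial B-subgroup α∈B X-cosets (a , a∈A , X∩fX≐aB , X∪aX≐A) ℓ B-size =
  Theorem6Proof.Proof.isDSRG G n enumeration A A-subgroup A-abelian A-size α β α∈A β∉A β²≈α f-closed
    X X-resp X-nontrivial B-subgroup α∈B X-cosets a a∈A X∩fX≐aB X∪aX≐A ℓ B-size
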